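{- Let $d\ge 3$ be an integer, let $\delta=\lfloor d/2\rfloor$, and let $\Delta$ be a $(d-1)$-dimensional finite simplicial complex with $f$-vector $(f_0,f_1,\ldots,f_{d-1})$ and $h$-vector $(h_0,\ldots,h_d)$, where $f_0>d$. Suppose that $h_i\ge h_{d-i}\ge 0$ for all $0\le i\le \delta$. Then $$f_{\lfloor 3(d-1)/4\rfloor}>\ldots>f_{d-2}>f_{d-1}.$$
   Context: For a $(d-1)$-dimensional simplicial complex $\Delta$, $f_i$ denotes the number of $i$-dimensional faces of $\Delta$ (faces with $i+1$ vertices), and $f_{ -1}=1$. The $h$-vector $(h_0,\ldots,h_d)$ is defined by the polynomial identity $\sum_{i=0}^{d} f_{i-1}x^{d-i}=\sum_{i=0}^{d} h_i(x+1)^{d-i}$. -}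

module Defs where

open import Data.Bool using (Bool; true; false; _∧_; if_then_else_)
open import Data.Nat using (ℕ; zero; suc; _≤_; _≡ᵇ_; _∸_)
open import Data.Vec using (_∷_; [])
open import Data.List using (List; []; _∷_; map; _++_; length; filter; foldr)
open import Data.Fin using (Fin; toℕ)
open import Data.Fin.Subset using (Subset; _⊆_; ∣_∣; inside; outside)
open import Data.Integer as ℤ using (ℤ)
open import Data.Product using (∃; _×_)
open import Relation.Binary.PropositionalEquality using (_≡_)
open import Relation.Nullary.Decidable using (does)
open import Data.Bool.Properties using (_≟_)

allSubsets : (n : ℕ) → List (Subset n)
allSubsets zero = [] ∷ []
allSubsets (suc n) = map (inside ∷_) (allSubsets n) ++ map (outside ∷_) (allSubsets n)

record SimplicialComplex (n : ℕ) : Set where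
  field
    isFace     : Subset n → Bool
    emptyFace  : isFace (Data.Vec.replicate n outside) ≡ true
    downClosed : ∀ σ τ → τ ⊆ σ → isFace σ ≡ true → isFace τ ≡ true
open SimplicialComplex public

faceCount : ∀ {n} → SimplicialComplex n → ℕ → ℕ
faceCount {n} Δ k = length (filter (λ σ → isFace Δ σ ∧ (∣ σ ∣ ≡ᵇ k) ≟ true) (allSubsets n))

-- f i = f_{i-1} in the paper's notation shifted: fv Δ i = number of i-dimensional faces
-- i.e. fv Δ i = f_i = faceCount Δ (i+1);  f_{-1} = faceCount Δ 0 (= 1).
fv : ∀ {n} → SimplicialComplex n → ℕ → ℕ
fv Δ i = faceCount Δ (suc i)

HasDim-1 : ∀ {n} → SimplicialComplex n → ℕ → Set
HasDim-1 {n} Δ d = (∃ λ σ → isFace Δ σ ≡ true × ∣ σ ∣ ≡ d)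
                 × (∀ σ → isFace Δ σ ≡ true → ∣ σ ∣ ≤ d)

sumTo : ℕ → (ℕ → ℤ) → ℤ
sumTo zero g = g 0
sumTo (suc d) g = sumTo d g ℤ.+ g (suc d)

-- A polynomial identity over ℤ holds iff it holds at every integer.
IsHVector : ∀ {n} → SimplicialComplex n → ℕ → (ℕ → ℤ) → Set
IsHVector Δ d h = ∀ (x : ℤ) →
  sumTo d (λ i → ℤ.+ (faceCount Δ i) ℤ.* (x ℤ.^ (d ∸ i)))
  ≡ sumTo d (λ i → h i ℤ.* ((x ℤ.+ ℤ.1ℤ) ℤ.^ (d ∸ i)))

module Submission where

-- Comparing coefficients of xᵏ in Σᵢ fᵢ₋₁ x^(d−i) = Σᵢ hᵢ (x+1)^(d−i) gives f_{d−k−1} = Σᵢ hᵢ C(d−i, k),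
-- so with t = d − 2 − j we get f_j − f_{j+1} = Σᵢ hᵢ Dᵢ, where Dᵢ = C(d−i, t+1) − C(d−i, t).
-- Group the terms i and d − i (i ≤ d/2) as (hᵢ − h_{d−i}) Dᵢ + h_{d−i} (Dᵢ + D_{d−i}).
-- The bound j ≥ ⌊3(d−1)/4⌋ says d ≥ 4t + 2. Then Dᵢ ≥ 0 because d − i ≥ 2t + 1 is past the middle of
-- its row, and Dᵢ + D_{d−i} ≥ 0 because, by Pascal's rule, C(a,t+1) − C(a,t) + C(b,t+1) − C(b,t) with
-- a + b fixed does not increase as a and b move towards each other, and it is nonnegative once both
-- are at least 2t + 1. So every group is nonnegative, and the group i = 0 is positive since h₀ = f₋₁ = 1.

open import Defs
open import Data.Nat as ℕ using (ℕ; zero; suc; _≤_; _<_; _∸_; z≤n; s≤s)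
import Data.Nat.Properties as ℕ
open import Data.Nat.Combinatorics using (_C_; nC1≡n; nCn≡1; k>n⇒nCk≡0; nCk+nC[k+1]≡[n+1]C[k+1])
open import Data.Integer as ℤ using (ℤ; +_; +[1+_]; 0ℤ; 1ℤ)
import Data.Integer.Properties as ℤ
open import Function using (_∘_)
open import Relation.Binary.PropositionalEquality
open import Relation.Nullary using (yes; no; contradiction)

module BinomialRows where

  open import Data.Nat using (_+_; _*_)
  open import Data.Nat.Solver using (module +-*-Solver)
  open +-*-Solver using (solve; _:=_; _:+_; _:*_; con)

  0<nCk : ∀ {n k} → k ≤ n → 0 < n C k
  0<nCk {n}     {zero}  _         = s≤s z≤n
  0<nCk {suc n} {suc k} (s≤s k≤n) = begin-strict
    0                       <⟨ 0<nCk k≤n ⟩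
    n C k                   ≤⟨ ℕ.m≤m+n (n C k) _ ⟩
    n C k + n C suc k       ≡⟨ nCk+nC[k+1]≡[n+1]C[k+1] n k ⟩
    suc n C suc k           ∎
    where open ℕ.≤-Reasoning

  [1+k]*nC[1+k]+k*nCk≡n*nCk : ∀ n k → suc k * (n C suc k) + k * (n C k) ≡ n * (n C k)
  [1+k]*nC[1+k]+k*nCk≡n*nCk zero    zero    = refl
  [1+k]*nC[1+k]+k*nCk≡n*nCk zero    (suc k) = cong₂ _+_ (ℕ.*-zeroʳ (suc (suc k))) (ℕ.*-zeroʳ (suc k))
  [1+k]*nC[1+k]+k*nCk≡n*nCk (suc n) zero    = begin
    1 * (suc n C 1) + 0     ≡⟨ ℕ.+-identityʳ _ ⟩
    1 * (suc n C 1)         ≡⟨ ℕ.*-identityˡ _ ⟩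
    suc n C 1               ≡⟨ nC1≡n (suc n) ⟩
    suc n                   ≡⟨ ℕ.*-identityʳ (suc n) ⟨
    suc n * 1               ∎
    where open ≡-Reasoning
  [1+k]*nC[1+k]+k*nCk≡n*nCk (suc n) (suc k) = begin
    suc (suc k) * (suc n C suc (suc k)) + suc k * (suc n C suc k)
      ≡⟨ cong₂ (λ x y → suc (suc k) * x + suc k * y) (pascal (suc k)) (pascal k) ⟨
    suc (suc k) * (c₁ + c₂) + suc k * (c₀ + c₁)
      ≡⟨ solve 4 (λ k c₀ c₁ c₂ → (con 2 :+ k) :* (c₁ :+ c₂) :+ (con 1 :+ k) :* (c₀ :+ c₁)
                  := ((con 2 :+ k) :* c₂ :+ (con 1 :+ k) :* c₁) :+ ((con 1 :+ k) :* c₁ :+ k :* c₀) :+ (c₁ :+ c₀))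
               refl k c₀ c₁ c₂ ⟩
    (suc (suc k) * c₂ + suc k * c₁) + (suc k * c₁ + k * c₀) + (c₁ + c₀)
      ≡⟨ cong₂ (λ x y → x + y + (c₁ + c₀)) ([1+k]*nC[1+k]+k*nCk≡n*nCk n (suc k)) ([1+k]*nC[1+k]+k*nCk≡n*nCk n k) ⟩
    n * c₁ + n * c₀ + (c₁ + c₀)
      ≡⟨ solve 3 (λ n c₀ c₁ → n :* c₁ :+ n :* c₀ :+ (c₁ :+ c₀) := (con 1 :+ n) :* (c₀ :+ c₁)) refl n c₀ c₁ ⟩
    suc n * (c₀ + c₁)
      ≡⟨ cong (suc n *_) (pascal k) ⟩
    suc n * (suc n C suc k)
      ∎
    where
    open ≡-Reasoning
    c₀ = n C k
    c₁ = n C suc k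
    c₂ = n C suc (suc k)
    pascal : ∀ j → n C j + n C suc j ≡ suc n C suc j
    pascal = nCk+nC[k+1]≡[n+1]C[k+1] n

  nCk≤nC[1+k] : ∀ {n k} → 1 + 2 * k ≤ n → n C k ≤ n C suc k
  nCk≤nC[1+k] {n} {k} 1+2k≤n = ℕ.*-cancelˡ-≤ (suc k) (ℕ.+-cancelʳ-≤ (k * (n C k)) _ _ (begin
    suc k * (n C k) + k * (n C k)        ≡⟨ solve 2 (λ k c → (con 1 :+ k) :* c :+ k :* c := (con 1 :+ con 2 :* k) :* c) refl k (n C k) ⟩
    (1 + 2 * k) * (n C k)                ≤⟨ ℕ.*-monoˡ-≤ (n C k) 1+2k≤n ⟩
    n * (n C k)                          ≡⟨ [1+k]*nC[1+k]+k*nCk≡n*nCk n k ⟨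
    suc k * (n C suc k) + k * (n C k)    ∎))
    where open ℕ.≤-Reasoning

  nC[1+k]≤nCk : ∀ {n k} → n ≤ 1 + 2 * k → n C suc k ≤ n C k
  nC[1+k]≤nCk {n} {k} n≤1+2k = ℕ.*-cancelˡ-≤ (suc k) (ℕ.+-cancelʳ-≤ (k * (n C k)) _ _ (begin
    suc k * (n C suc k) + k * (n C k)    ≡⟨ [1+k]*nC[1+k]+k*nCk≡n*nCk n k ⟩
    n * (n C k)                          ≤⟨ ℕ.*-monoˡ-≤ (n C k) n≤1+2k ⟩
    (1 + 2 * k) * (n C k)                ≡⟨ solve 2 (λ k c → (con 1 :+ con 2 :* k) :* c := (con 1 :+ k) :* c :+ k :* c) refl k (n C k) ⟩
    suc k * (n C k) + k * (n C k)        ∎))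
    where open ℕ.≤-Reasoning

  nCk<nC[1+k] : ∀ {n k} → 2 + 2 * k ≤ n → n C k < n C suc k
  nCk<nC[1+k] {n} {k} 2+2k≤n = ℕ.*-cancelˡ-< (suc k) _ _ (ℕ.+-cancelʳ-< (k * (n C k)) _ _ (begin-strict
    suc k * (n C k) + k * (n C k)             <⟨ ℕ.m<m+n _ (0<nCk k≤n) ⟩
    suc k * (n C k) + k * (n C k) + n C k     ≡⟨ solve 2 (λ k c → (con 1 :+ k) :* c :+ k :* c :+ c := (con 2 :+ con 2 :* k) :* c) refl k (n C k) ⟩
    (2 + 2 * k) * (n C k)                     ≤⟨ ℕ.*-monoˡ-≤ (n C k) 2+2k≤n ⟩
    n * (n C k)                               ≡⟨ [1+k]*nC[1+k]+k*nCk≡n*nCk n k ⟨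
    suc k * (n C suc k) + k * (n C k)         ∎))
    where
    open ℕ.≤-Reasoning
    k≤n : k ≤ n
    k≤n = ℕ.≤-trans (ℕ.≤-trans (ℕ.m≤n*m k 2) (ℕ.m≤n+m (2 * k) 2)) 2+2k≤n

  1+2[1+t]≤m⇒1+2t≤m : ∀ {m} t → 1 + 2 * suc t ≤ m → 1 + 2 * t ≤ m
  1+2[1+t]≤m⇒1+2t≤m t = ℕ.≤-trans (ℕ.+-monoʳ-≤ 1 (ℕ.*-monoʳ-≤ 2 (ℕ.n≤1+n t)))

  2+4t≤m+m⇒1+2t≤m : ∀ {t m} → 2 + 4 * t ≤ m + m → 1 + 2 * t ≤ m
  2+4t≤m+m⇒1+2t≤m {t} {m} 2+4t≤m+m = ℕ.*-cancelˡ-≤ 2 (begin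
    2 * (1 + 2 * t)    ≡⟨ solve 1 (λ t → con 2 :* (con 1 :+ con 2 :* t) := con 2 :+ con 4 :* t) refl t ⟩
    2 + 4 * t          ≤⟨ 2+4t≤m+m ⟩
    m + m              ≡⟨ solve 1 (λ m → m :+ m := con 2 :* m) refl m ⟩
    2 * m              ∎)
    where open ℕ.≤-Reasoning

module IntegerOrder where

  open import Data.Integer using (_+_; _*_; _-_; -_)
  open import Data.Integer.Solver using (module +-*-Solver)
  open +-*-Solver using (solve; _:=_; _:+_; _:-_; _:*_)

  j<i⇒0<i-j : ∀ {i j} → j ℤ.< i → 0ℤ ℤ.< i - j
  j<i⇒0<i-j {i} {j} j<i = subst (ℤ._< i - j) (ℤ.+-inverseʳ j) (ℤ.+-monoˡ-< (- j) j<i)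

  0<i-j⇒j<i : ∀ {i j} → 0ℤ ℤ.< i - j → j ℤ.< i
  0<i-j⇒j<i {i} {j} 0<i-j =
    subst₂ ℤ._<_ (ℤ.+-identityʳ j) (solve 2 (λ i j → j :+ (i :- j) := i) refl i j) (ℤ.+-monoʳ-< j 0<i-j)

  0≤i*j : ∀ {i j} → 0ℤ ℤ.≤ i → 0ℤ ℤ.≤ j → 0ℤ ℤ.≤ i * j
  0≤i*j {+ m} {+ n} _ _ = subst (0ℤ ℤ.≤_) (ℤ.pos-* m n) (ℤ.+≤+ z≤n)

  0<i*j : ∀ {i j} → 0ℤ ℤ.< i → 0ℤ ℤ.< j → 0ℤ ℤ.< i * j
  0<i*j {+[1+ m ]} {+[1+ n ]} _          _          = ℤ.+<+ (s≤s z≤n)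
  0<i*j {+ zero}   {_}        (ℤ.+<+ ()) _
  0<i*j {+[1+ m ]} {+ zero}   _          (ℤ.+<+ ())

  0<i+i⇒0<i : ∀ i → 0ℤ ℤ.< i + i → 0ℤ ℤ.< i
  0<i+i⇒0<i i 0<i+i with 0ℤ ℤ.<? i
  ... | yes 0<i = 0<i
  ... | no  0≮i = contradiction (ℤ.≤-<-trans (ℤ.+-mono-≤ i≤0 i≤0) 0<i+i) (ℤ.<-irrefl refl)
    where
    i≤0 : i ℤ.≤ 0ℤ
    i≤0 = ℤ.≮⇒≥ 0≮i

  p*a+q*b≡[p-q]*a+q*[a+b] : ∀ p q a b → p * a + q * b ≡ (p - q) * a + q * (a + b)
  p*a+q*b≡[p-q]*a+q*[a+b] = solve 4 (λ p q a b → p :* a :+ q :* b := (p :- q) :* a :+ q :* (a :+ b)) refl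

  weighted-pair-nonneg : ∀ {p q a b} → 0ℤ ℤ.≤ q → q ℤ.≤ p → 0ℤ ℤ.≤ a → 0ℤ ℤ.≤ a + b → 0ℤ ℤ.≤ p * a + q * b
  weighted-pair-nonneg {p} {q} {a} {b} 0≤q q≤p 0≤a 0≤a+b =
    subst (0ℤ ℤ.≤_) (sym (p*a+q*b≡[p-q]*a+q*[a+b] p q a b))
      (ℤ.+-mono-≤ (0≤i*j (ℤ.i≤j⇒0≤j-i q≤p) 0≤a) (0≤i*j 0≤q 0≤a+b))

  weighted-pair-pos : ∀ {p q a b} → 0ℤ ℤ.< p → 0ℤ ℤ.≤ q → q ℤ.≤ p → 0ℤ ℤ.< a → 0ℤ ℤ.< a + b →
                      0ℤ ℤ.< p * a + q * b
  weighted-pair-pos {p} {+ zero}   {a} {b} 0<p _ _   0<a _ =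
    subst (0ℤ ℤ.<_) (sym (trans (cong (_+_ (p * a)) (ℤ.*-zeroˡ b)) (ℤ.+-identityʳ (p * a)))) (0<i*j 0<p 0<a)
  weighted-pair-pos {p} {+[1+ k ]} {a} {b} _   _ q≤p 0<a 0<a+b =
    subst (0ℤ ℤ.<_) (sym (p*a+q*b≡[p-q]*a+q*[a+b] p +[1+ k ] a b))
      (ℤ.+-mono-≤-< (0≤i*j (ℤ.i≤j⇒0≤j-i q≤p) (ℤ.<⇒≤ 0<a)) (0<i*j {i = +[1+ k ]} (ℤ.+<+ (s≤s z≤n)) 0<a+b))

module FiniteSums where

  open IntegerOrder using (0<i+i⇒0<i)
  open import Data.Integer using (_+_; _*_; _-_)
  open import Data.Integer.Solver using (module +-*-Solver)
  open import Data.Sum using (inj₁; inj₂)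
  open +-*-Solver using (solve; _:=_; _:+_; _:-_)

  sumTo-cong : ∀ N {f g : ℕ → ℤ} → (∀ i → i ≤ N → f i ≡ g i) → sumTo N f ≡ sumTo N g
  sumTo-cong zero    f≡g = f≡g 0 z≤n
  sumTo-cong (suc N) f≡g =
    cong₂ _+_ (sumTo-cong N (λ i i≤N → f≡g i (ℕ.m≤n⇒m≤1+n i≤N))) (f≡g (suc N) ℕ.≤-refl)

  sumTo-suc : ∀ N (f : ℕ → ℤ) → sumTo (suc N) f ≡ f 0 + sumTo N (λ i → f (suc i))
  sumTo-suc zero    f = refl
  sumTo-suc (suc N) f = begin
    sumTo (suc N) f + f (suc (suc N))                      ≡⟨ cong (_+ f (suc (suc N))) (sumTo-suc N f) ⟩
    f 0 + sumTo N (λ i → f (suc i)) + f (suc (suc N))      ≡⟨ ℤ.+-assoc (f 0) _ _ ⟩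
    f 0 + sumTo (suc N) (λ i → f (suc i))                  ∎
    where open ≡-Reasoning

  sumTo-distrib-+ : ∀ N (f g : ℕ → ℤ) → sumTo N (λ i → f i + g i) ≡ sumTo N f + sumTo N g
  sumTo-distrib-+ zero    f g = refl
  sumTo-distrib-+ (suc N) f g rewrite sumTo-distrib-+ N f g =
    solve 4 (λ a b c d → (a :+ b) :+ (c :+ d) := (a :+ c) :+ (b :+ d)) refl
      (sumTo N f) (sumTo N g) (f (suc N)) (g (suc N))

  sumTo-distrib-minus : ∀ N (f g : ℕ → ℤ) → sumTo N (λ i → f i - g i) ≡ sumTo N f - sumTo N g
  sumTo-distrib-minus zero    f g = refl
  sumTo-distrib-minus (suc N) f g rewrite sumTo-distrib-minus N f g =
    solve 4 (λ a b c d → (a :- b) :+ (c :- d) := (a :+ c) :- (b :+ d)) refl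
      (sumTo N f) (sumTo N g) (f (suc N)) (g (suc N))

  *-distribˡ-sumTo : ∀ N c (f : ℕ → ℤ) → c * sumTo N f ≡ sumTo N (λ i → c * f i)
  *-distribˡ-sumTo zero    c f = refl
  *-distribˡ-sumTo (suc N) c f = begin
    c * (sumTo N f + f (suc N))                  ≡⟨ ℤ.*-distribˡ-+ c (sumTo N f) (f (suc N)) ⟩
    c * sumTo N f + c * f (suc N)                ≡⟨ cong (_+ c * f (suc N)) (*-distribˡ-sumTo N c f) ⟩
    sumTo N (λ i → c * f i) + c * f (suc N)      ∎
    where open ≡-Reasoning

  *-distribʳ-sumTo : ∀ N c (f : ℕ → ℤ) → sumTo N f * c ≡ sumTo N (λ i → f i * c)
  *-distribʳ-sumTo N c f = begin
    sumTo N f * c                ≡⟨ ℤ.*-comm (sumTo N f) c ⟩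
    c * sumTo N f                ≡⟨ *-distribˡ-sumTo N c f ⟩
    sumTo N (λ i → c * f i)      ≡⟨ sumTo-cong N (λ i _ → ℤ.*-comm c (f i)) ⟩
    sumTo N (λ i → f i * c)      ∎
    where open ≡-Reasoning

  sumTo-comm : ∀ N M (f : ℕ → ℕ → ℤ) →
               sumTo N (λ i → sumTo M (f i)) ≡ sumTo M (λ k → sumTo N (λ i → f i k))
  sumTo-comm zero    M f = refl
  sumTo-comm (suc N) M f rewrite sumTo-comm N M f =
    sym (sumTo-distrib-+ M (λ k → sumTo N (λ i → f i k)) (f (suc N)))

  sumTo-reverse : ∀ N (f : ℕ → ℤ) → sumTo N f ≡ sumTo N (λ i → f (N ∸ i))
  sumTo-reverse zero    f = refl
  sumTo-reverse (suc N) f = begin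
    sumTo N f + f (suc N)                          ≡⟨ cong (_+ f (suc N)) (sumTo-reverse N f) ⟩
    sumTo N (λ i → f (N ∸ i)) + f (suc N)          ≡⟨ ℤ.+-comm _ (f (suc N)) ⟩
    f (suc N) + sumTo N (λ i → f (N ∸ i))          ≡⟨ sumTo-suc N (λ i → f (suc N ∸ i)) ⟨
    sumTo (suc N) (λ i → f (suc N ∸ i))            ∎
    where open ≡-Reasoning

  sumTo-truncate : ∀ {m} N {f : ℕ → ℤ} → m ≤ N → (∀ i → m < i → i ≤ N → f i ≡ 0ℤ) → sumTo N f ≡ sumTo m f
  sumTo-truncate zero                z≤n    _   = refl
  sumTo-truncate {m} (suc N) {f} m≤1+N f≡0 with ℕ.m≤n⇒m<n∨m≡n m≤1+N
  ... | inj₂ refl = refl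
  ... | inj₁ m<1+N = begin
    sumTo N f + f (suc N)   ≡⟨ cong₂ _+_ (sumTo-truncate N (ℕ.≤-pred m<1+N) f≡0′) (f≡0 (suc N) m<1+N ℕ.≤-refl) ⟩
    sumTo m f + 0ℤ          ≡⟨ ℤ.+-identityʳ _ ⟩
    sumTo m f               ∎
    where
    open ≡-Reasoning
    f≡0′ : ∀ i → m < i → i ≤ N → f i ≡ 0ℤ
    f≡0′ i m<i i≤N = f≡0 i m<i (ℕ.m≤n⇒m≤1+n i≤N)

  0≤sumTo : ∀ N {f : ℕ → ℤ} → (∀ i → i ≤ N → 0ℤ ℤ.≤ f i) → 0ℤ ℤ.≤ sumTo N f
  0≤sumTo zero    0≤f = 0≤f 0 z≤n
  0≤sumTo (suc N) 0≤f = ℤ.+-mono-≤ (0≤sumTo N (λ i i≤N → 0≤f i (ℕ.m≤n⇒m≤1+n i≤N))) (0≤f (suc N) ℕ.≤-refl)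

  0<sumTo : ∀ N {f : ℕ → ℤ} → 0ℤ ℤ.< f 0 → (∀ i → i ≤ N → 0ℤ ℤ.≤ f i) → 0ℤ ℤ.< sumTo N f
  0<sumTo zero    0<f₀ _   = 0<f₀
  0<sumTo (suc N) {f} 0<f₀ 0≤f = subst (0ℤ ℤ.<_) (sym (sumTo-suc N f))
    (ℤ.+-mono-<-≤ 0<f₀ (0≤sumTo N (λ i i≤N → 0≤f (suc i) (s≤s i≤N))))

  0<sumTo-by-pairing : ∀ N (g : ℕ → ℤ) → (∀ i → i ℕ.+ i ≤ N → 0ℤ ℤ.≤ g i + g (N ∸ i)) →
                       0ℤ ℤ.< g 0 + g N → 0ℤ ℤ.< sumTo N g
  0<sumTo-by-pairing N g 0≤pair 0<pair₀ = 0<i+i⇒0<i (sumTo N g) (subst (0ℤ ℤ.<_) twice (0<sumTo N 0<pair₀ 0≤pair′))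
    where
    pair : ℕ → ℤ
    pair i = g i + g (N ∸ i)
    twice : sumTo N pair ≡ sumTo N g + sumTo N g
    twice = trans (sumTo-distrib-+ N g (λ i → g (N ∸ i))) (cong (_+_ (sumTo N g)) (sym (sumTo-reverse N g)))
    0≤pair′ : ∀ i → i ≤ N → 0ℤ ℤ.≤ pair i
    0≤pair′ i i≤N with i ℕ.+ i ℕ.≤? N
    ... | yes 2i≤N = 0≤pair i 2i≤N
    ... | no  2i≰N = subst (0ℤ ℤ.≤_) mirror (0≤pair j 2j≤N)
      where
      j = N ∸ i
      j+i≡N : j ℕ.+ i ≡ N
      j+i≡N = ℕ.m∸n+n≡m i≤N
      j<i : j < i
      j<i = ℕ.+-cancelʳ-< i j i (subst (ℕ._< i ℕ.+ i) (sym j+i≡N) (ℕ.≰⇒> 2i≰N))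
      2j≤N : j ℕ.+ j ≤ N
      2j≤N = ℕ.≤-trans (ℕ.+-monoʳ-≤ j (ℕ.<⇒≤ j<i)) (ℕ.≤-reflexive j+i≡N)
      mirror : pair j ≡ pair i
      mirror = trans (cong (λ k → g j + g k) (ℕ.m∸[m∸n]≡n i≤N)) (ℤ.+-comm (g j) (g i))

module BinomialTheorem where

  open FiniteSums
  open import Data.Integer using (_+_; _*_; _^_)
  open import Data.Fin using (toℕ)
  open import Algebra.Properties.CommutativeSemiring.Binomial ℤ.+-*-commutativeSemiring as Binomial
    using (binomialExpansion)
  open import Algebra.Properties.Semiring.Sum ℤ.+-*-semiring using (sum-cong-≗; sum⁺-syntax)
  open import Algebra.Definitions.RawMonoid ℤ.+-0-rawMonoid using (_×_)
  open import Algebra.Definitions.RawSemiring ℤ.+-*-rawSemiring using () renaming (_^_ to _^ᴿ_)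

  sumTo-as-∑ : ∀ N (f : ℕ → ℤ) → sumTo N f ≡ ∑[ k ≤ N ] f (toℕ k)
  sumTo-as-∑ zero    f = sym (ℤ.+-identityʳ (f 0))
  sumTo-as-∑ (suc N) f = trans (sumTo-suc N f) (cong (_+_ (f 0)) (sumTo-as-∑ N (λ i → f (suc i))))

  ×-as-* : ∀ n x → n × x ≡ + n * x
  ×-as-* zero    x = sym (ℤ.*-zeroˡ x)
  ×-as-* (suc n) x = trans (cong (_+_ x) (×-as-* n x)) (sym (ℤ.suc-* (+ n) x))

  ^ᴿ-as-^ : ∀ x n → x ^ᴿ n ≡ x ^ n
  ^ᴿ-as-^ x zero    = refl
  ^ᴿ-as-^ x (suc n) = cong (_*_ x) (^ᴿ-as-^ x n)

  binomial-theorem : ∀ m x → (x + 1ℤ) ^ m ≡ sumTo m (λ k → + (m C k) * x ^ k)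
  binomial-theorem m x = begin
    (x + 1ℤ) ^ m                                   ≡⟨ ^ᴿ-as-^ (x + 1ℤ) m ⟨
    (x + 1ℤ) ^ᴿ m                                  ≡⟨ Binomial.theorem m x 1ℤ ⟩
    binomialExpansion x 1ℤ m                       ≡⟨ sum-cong-≗ {suc m} (λ k → term (toℕ k)) ⟩
    ∑[ k ≤ m ] (+ (m C toℕ k) * x ^ toℕ k)         ≡⟨ sumTo-as-∑ m _ ⟨
    sumTo m (λ k → + (m C k) * x ^ k)              ∎
    where
    open ≡-Reasoning
    term : ∀ k → (m C k) × (x ^ᴿ k * 1ℤ ^ᴿ (m ∸ k)) ≡ + (m C k) * x ^ k
    term k rewrite ^ᴿ-as-^ x k | ^ᴿ-as-^ 1ℤ (m ∸ k) | ℤ.^-zeroˡ (m ∸ k) | ℤ.*-identityʳ (x ^ k) =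
      ×-as-* (m C k) (x ^ k)

  binomial-theorem-upTo : ∀ {m N} x → m ≤ N → (x + 1ℤ) ^ m ≡ sumTo N (λ k → + (m C k) * x ^ k)
  binomial-theorem-upTo {m} {N} x m≤N = begin
    (x + 1ℤ) ^ m                             ≡⟨ binomial-theorem m x ⟩
    sumTo m (λ k → + (m C k) * x ^ k)        ≡⟨ sumTo-truncate N m≤N vanishing ⟨
    sumTo N (λ k → + (m C k) * x ^ k)        ∎
    where
    open ≡-Reasoning
    vanishing : ∀ k → m < k → k ≤ N → + (m C k) * x ^ k ≡ 0ℤ
    vanishing k m<k _ rewrite k>n⇒nCk≡0 m<k = ℤ.*-zeroˡ (x ^ k)

module PolynomialIdentity where

  open FiniteSums
  open import Data.Integer using (_+_; _*_; _-_; -_; _^_)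
  open import Data.Integer.Solver using (module +-*-Solver)
  open import Algebra.Properties.Ring ℤ.+-*-ring using ([y-z]x≈yx-zx)
  open import Data.Nat.Divisibility using (_∣_; divides; >⇒∤)
  open +-*-Solver using (solve; _:=_; _:+_; _:*_; :-_)

  sumTo-horner : ∀ N (c : ℕ → ℤ) x →
                 sumTo (suc N) (λ k → c k * x ^ k) ≡ c 0 + x * sumTo N (λ k → c (suc k) * x ^ k)
  sumTo-horner N c x = begin
    sumTo (suc N) (λ k → c k * x ^ k)                     ≡⟨ sumTo-suc N _ ⟩
    c 0 * 1ℤ + sumTo N (λ k → c (suc k) * (x * x ^ k))    ≡⟨ cong₂ _+_ (ℤ.*-identityʳ (c 0)) (sumTo-cong N (λ k _ → shift k)) ⟩
    c 0 + sumTo N (λ k → x * (c (suc k) * x ^ k))         ≡⟨ cong (_+_ (c 0)) (*-distribˡ-sumTo N x _) ⟨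
    c 0 + x * sumTo N (λ k → c (suc k) * x ^ k)           ∎
    where
    open ≡-Reasoning
    shift : ∀ k → c (suc k) * (x * x ^ k) ≡ x * (c (suc k) * x ^ k)
    shift k = solve 3 (λ a y z → a :* (y :* z) := y :* (a :* z)) refl (c (suc k)) x (x ^ k)

  -- Evaluating at x = ∣ c ∣ makes 1 + ∣ c ∣ divide ∣ c ∣.
  constant-term-vanishes : ∀ c (q : ℕ → ℤ) → (∀ x → c + + suc x * q x ≡ 0ℤ) → c ≡ 0ℤ
  constant-term-vanishes c q vanish = ℤ.∣i∣≡0⇒i≡0 (divides-predecessor (divides ℤ.∣ q a ∣ ∣c∣≡∣q∣*[1+a]))
    where
    a = ℤ.∣ c ∣
    c≡-[1+a]q : c ≡ - (+ suc a * q a)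
    c≡-[1+a]q = begin
      c                                      ≡⟨ solve 2 (λ c y → c := (c :+ y) :+ (:- y)) refl c (+ suc a * q a) ⟩
      c + + suc a * q a + - (+ suc a * q a)  ≡⟨ cong (_+ - (+ suc a * q a)) (vanish a) ⟩
      0ℤ + - (+ suc a * q a)                 ≡⟨ ℤ.+-identityˡ _ ⟩
      - (+ suc a * q a)                      ∎
      where open ≡-Reasoning
    ∣c∣≡∣q∣*[1+a] : a ≡ ℤ.∣ q a ∣ ℕ.* suc a
    ∣c∣≡∣q∣*[1+a] = begin
      ℤ.∣ c ∣                        ≡⟨ cong ℤ.∣_∣ c≡-[1+a]q ⟩
      ℤ.∣ - (+ suc a * q a) ∣        ≡⟨ ℤ.∣-i∣≡∣i∣ (+ suc a * q a) ⟩
      ℤ.∣ + suc a * q a ∣            ≡⟨ ℤ.abs-* (+ suc a) (q a) ⟩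
      suc a ℕ.* ℤ.∣ q a ∣            ≡⟨ ℕ.*-comm (suc a) _ ⟩
      ℤ.∣ q a ∣ ℕ.* suc a            ∎
      where open ≡-Reasoning
    divides-predecessor : ∀ {m} → suc m ∣ m → m ≡ 0
    divides-predecessor {zero}  _       = refl
    divides-predecessor {suc m} [1+m]∣m = contradiction [1+m]∣m (>⇒∤ (ℕ.n<1+n (suc m)))

  coefficients-vanish : ∀ N (c : ℕ → ℤ) → (∀ x → sumTo N (λ k → c k * (+ suc x) ^ k) ≡ 0ℤ) →
                        ∀ k → k ≤ N → c k ≡ 0ℤ
  coefficients-vanish zero    c vanish zero z≤n = trans (sym (ℤ.*-identityʳ (c 0))) (vanish 0)
  coefficients-vanish (suc N) c vanish = vanish-at
    where
    tail : ℕ → ℤ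
    tail x = sumTo N (λ k → c (suc k) * (+ suc x) ^ k)
    split : ∀ x → c 0 + + suc x * tail x ≡ 0ℤ
    split x = trans (sym (sumTo-horner N c (+ suc x))) (vanish x)
    c₀≡0 : c 0 ≡ 0ℤ
    c₀≡0 = constant-term-vanishes (c 0) tail split
    scaled-tail-vanishes : ∀ x → + suc x * tail x ≡ 0ℤ
    scaled-tail-vanishes x = begin
      + suc x * tail x          ≡⟨ ℤ.+-identityˡ _ ⟨
      0ℤ + + suc x * tail x     ≡⟨ cong (_+ (+ suc x * tail x)) c₀≡0 ⟨
      c 0 + + suc x * tail x    ≡⟨ split x ⟩
      0ℤ                        ∎
      where open ≡-Reasoning
    tail-vanishes : ∀ x → tail x ≡ 0ℤ
    tail-vanishes x = ℤ.*-cancelˡ-≡ (+ suc x) (tail x) 0ℤ (trans (scaled-tail-vanishes x) (sym (ℤ.*-zeroʳ (+ suc x))))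
    vanish-at : ∀ k → k ≤ suc N → c k ≡ 0ℤ
    vanish-at zero    _         = c₀≡0
    vanish-at (suc k) (s≤s k≤N) = coefficients-vanish N (c ∘ suc) tail-vanishes k k≤N

  coefficients-unique : ∀ N (a b : ℕ → ℤ) →
                        (∀ x → sumTo N (λ k → a k * (+ suc x) ^ k) ≡ sumTo N (λ k → b k * (+ suc x) ^ k)) →
                        ∀ k → k ≤ N → a k ≡ b k
  coefficients-unique N a b same k k≤N =
    ℤ.i-j≡0⇒i≡j (a k) (b k) (coefficients-vanish N (λ k → a k - b k) difference-vanishes k k≤N)
    where
    difference-vanishes : ∀ x → sumTo N (λ k → (a k - b k) * (+ suc x) ^ k) ≡ 0ℤ
    difference-vanishes x = begin
      sumTo N (λ k → (a k - b k) * X ^ k)                        ≡⟨ sumTo-cong N (λ k _ → [y-z]x≈yx-zx (X ^ k) (a k) (b k)) ⟩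
      sumTo N (λ k → a k * X ^ k - b k * X ^ k)                  ≡⟨ sumTo-distrib-minus N _ _ ⟩
      sumTo N (λ k → a k * X ^ k) - sumTo N (λ k → b k * X ^ k)  ≡⟨ ℤ.i≡j⇒i-j≡0 (same x) ⟩
      0ℤ                                                         ∎
      where
      open ≡-Reasoning
      X = + suc x

module RowDifferences where

  open BinomialRows
  open IntegerOrder using (j<i⇒0<i-j)
  open import Data.Nat using (_≤′_; ≤′-refl; ≤′-step)
  open import Data.Integer using (_+_; _-_)
  open import Data.Integer.Solver using (module +-*-Solver)
  open +-*-Solver using (solve; _:=_; _:+_; _:-_; con)

  rowDiff : ℕ → ℕ → ℤ
  rowDiff m t = + (m C suc t) - + (m C t)

  rowDiff-nonneg : ∀ {m t} → 1 ℕ.+ 2 ℕ.* t ≤ m → 0ℤ ℤ.≤ rowDiff m t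
  rowDiff-nonneg {t = t} 1+2t≤m = ℤ.i≤j⇒0≤j-i (ℤ.+≤+ (nCk≤nC[1+k] {k = t} 1+2t≤m))

  rowDiff-nonpos : ∀ {m t} → m ≤ 1 ℕ.+ 2 ℕ.* t → rowDiff m t ℤ.≤ 0ℤ
  rowDiff-nonpos {t = t} m≤1+2t = ℤ.i≤j⇒i-j≤0 (ℤ.+≤+ (nC[1+k]≤nCk {k = t} m≤1+2t))

  rowDiff-pos : ∀ {m t} → 2 ℕ.+ 2 ℕ.* t ≤ m → 0ℤ ℤ.< rowDiff m t
  rowDiff-pos {t = t} 2+2t≤m = j<i⇒0<i-j (ℤ.+<+ (nCk<nC[1+k] {k = t} 2+2t≤m))

  rowDiff-suc : ∀ m t → rowDiff (suc m) (suc t) ≡ rowDiff m (suc t) + rowDiff m t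
  rowDiff-suc m t = begin
    + (suc m C suc (suc t)) - + (suc m C suc t)
      ≡⟨ cong₂ (λ x y → + x - + y) (pascal (suc t)) (pascal t) ⟨
    + (c₁ ℕ.+ c₂) - + (c₀ ℕ.+ c₁)
      ≡⟨ cong₂ _-_ (ℤ.pos-+ c₁ c₂) (ℤ.pos-+ c₀ c₁) ⟩
    (+ c₁ + + c₂) - (+ c₀ + + c₁)
      ≡⟨ solve 3 (λ a b c → (b :+ c) :- (a :+ b) := (c :- b) :+ (b :- a)) refl (+ c₀) (+ c₁) (+ c₂) ⟩
    rowDiff m (suc t) + rowDiff m t
      ∎
    where
    open ≡-Reasoning
    c₀ = m C t
    c₁ = m C suc t
    c₂ = m C suc (suc t)
    pascal : ∀ j → m C j ℕ.+ m C suc j ≡ suc m C suc j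
    pascal = nCk+nC[k+1]≡[n+1]C[k+1] m

  rowDiff-suc-zero : ∀ m → rowDiff (suc m) 0 ≡ 1ℤ + rowDiff m 0
  rowDiff-suc-zero m rewrite nC1≡n m | nC1≡n (suc m) =
    solve 1 (λ m → (con 1ℤ :+ m) :- con 1ℤ := con 1ℤ :+ (m :- con 1ℤ)) refl (+ m)

  rowDiff-step : ∀ {m} t → 1 ℕ.+ 2 ℕ.* t ≤ m → rowDiff m t ℤ.≤ rowDiff (suc m) t
  rowDiff-step {m} zero    _         rewrite rowDiff-suc-zero m = ℤ.i≤j+i (rowDiff m 0) 1ℤ
  rowDiff-step {m} (suc t) 3+2t≤m = begin
    rowDiff m (suc t)                  ≡⟨ ℤ.+-identityʳ _ ⟨
    rowDiff m (suc t) + 0ℤ             ≤⟨ ℤ.+-monoʳ-≤ (rowDiff m (suc t)) (rowDiff-nonneg {t = t} 1+2t≤m) ⟩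
    rowDiff m (suc t) + rowDiff m t    ≡⟨ rowDiff-suc m t ⟨
    rowDiff (suc m) (suc t)            ∎
    where
    open ℤ.≤-Reasoning
    1+2t≤m = 1+2[1+t]≤m⇒1+2t≤m t 3+2t≤m

  rowDiff-mono : ∀ {m M} t → m ≤ M → 1 ℕ.+ 2 ℕ.* t ≤ M → rowDiff m t ℤ.≤ rowDiff M t
  rowDiff-mono {m} t m≤M 1+2t≤M with 1 ℕ.+ 2 ℕ.* t ℕ.≤? m
  ... | yes 1+2t≤m = increasing (ℕ.≤⇒≤′ m≤M)
    where
    increasing : ∀ {M} → m ≤′ M → rowDiff m t ℤ.≤ rowDiff M t
    increasing ≤′-refl           = ℤ.≤-refl
    increasing (≤′-step m≤′M) = ℤ.≤-trans (increasing m≤′M) (rowDiff-step t (ℕ.≤-trans 1+2t≤m (ℕ.≤′⇒≤ m≤′M)))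
  ... | no 1+2t≰m = ℤ.≤-trans (rowDiff-nonpos {t = t} (ℕ.<⇒≤ (ℕ.≰⇒> 1+2t≰m))) (rowDiff-nonneg {t = t} 1+2t≤M)

  rowDiff-spread : ∀ {a b} t → b ≤ a → 1 ℕ.+ 2 ℕ.* t ≤ a →
                   rowDiff a t + rowDiff (suc b) t ℤ.≤ rowDiff (suc a) t + rowDiff b t
  rowDiff-spread {a} {b} zero    _   _ = ℤ.≤-reflexive (begin
    rowDiff a 0 + rowDiff (suc b) 0
      ≡⟨ cong (_+_ (rowDiff a 0)) (rowDiff-suc-zero b) ⟩
    rowDiff a 0 + (1ℤ + rowDiff b 0)
      ≡⟨ solve 2 (λ x y → x :+ (con 1ℤ :+ y) := (con 1ℤ :+ x) :+ y) refl (rowDiff a 0) (rowDiff b 0) ⟩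
    (1ℤ + rowDiff a 0) + rowDiff b 0
      ≡⟨ cong (_+ rowDiff b 0) (rowDiff-suc-zero a) ⟨
    rowDiff (suc a) 0 + rowDiff b 0
      ∎)
    where open ≡-Reasoning
  rowDiff-spread {a} {b} (suc t) b≤a 3+2t≤a = begin
    A₁ + rowDiff (suc b) (suc t)    ≡⟨ cong (_+_ A₁) (rowDiff-suc b t) ⟩
    A₁ + (B₁ + B₀)                  ≡⟨ ℤ.+-assoc A₁ B₁ B₀ ⟨
    A₁ + B₁ + B₀                    ≤⟨ ℤ.+-monoʳ-≤ (A₁ + B₁) (rowDiff-mono t b≤a (1+2[1+t]≤m⇒1+2t≤m t 3+2t≤a)) ⟩
    A₁ + B₁ + A₀                    ≡⟨ solve 3 (λ x y z → x :+ y :+ z := (x :+ z) :+ y) refl A₁ B₁ A₀ ⟩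
    (A₁ + A₀) + B₁                  ≡⟨ cong (_+ B₁) (rowDiff-suc a t) ⟨
    rowDiff (suc a) (suc t) + B₁    ∎
    where
    open ℤ.≤-Reasoning
    A₀ = rowDiff a t
    A₁ = rowDiff a (suc t)
    B₀ = rowDiff b t
    B₁ = rowDiff b (suc t)

  rowDiff-pair-nonneg : ∀ {a b} t → b ≤ a → 2 ℕ.+ 4 ℕ.* t ≤ a ℕ.+ b → 0ℤ ℤ.≤ rowDiff a t + rowDiff b t
  rowDiff-pair-nonneg {zero}  {zero} t z≤n ()
  rowDiff-pair-nonneg {suc a} {b}    t b≤1+a bound with 1 ℕ.+ 2 ℕ.* t ℕ.≤? b
  ... | yes 1+2t≤b = ℤ.+-mono-≤ (rowDiff-nonneg {t = t} (ℕ.≤-trans 1+2t≤b b≤1+a)) (rowDiff-nonneg {t = t} 1+2t≤b)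
  ... | no 1+2t≰b  = ℤ.≤-trans (rowDiff-pair-nonneg t 1+b≤a bound′) (rowDiff-spread t (ℕ.<⇒≤ 1+b≤a) 1+2t≤a)
    where
    open ℕ.≤-Reasoning
    b≤2t : b ≤ 2 ℕ.* t
    b≤2t = ℕ.≤-pred (ℕ.≰⇒> 1+2t≰b)
    1+2t≤a : 1 ℕ.+ 2 ℕ.* t ≤ a
    1+2t≤a = ℕ.≤-pred (ℕ.+-cancelʳ-≤ b _ _ (begin
      2 ℕ.+ 2 ℕ.* t ℕ.+ b              ≤⟨ ℕ.+-monoʳ-≤ (2 ℕ.+ 2 ℕ.* t) b≤2t ⟩
      2 ℕ.+ 2 ℕ.* t ℕ.+ 2 ℕ.* t        ≡⟨ ℕ.+-assoc 2 (2 ℕ.* t) (2 ℕ.* t) ⟩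
      2 ℕ.+ (2 ℕ.* t ℕ.+ 2 ℕ.* t)      ≡⟨ cong (2 ℕ.+_) (ℕ.*-distribʳ-+ t 2 2) ⟨
      2 ℕ.+ 4 ℕ.* t                    ≤⟨ bound ⟩
      suc a ℕ.+ b                      ∎))
    1+b≤a : suc b ≤ a
    1+b≤a = ℕ.≤-trans (s≤s b≤2t) 1+2t≤a
    bound′ : 2 ℕ.+ 4 ℕ.* t ≤ a ℕ.+ suc b
    bound′ = ℕ.≤-trans bound (ℕ.≤-reflexive (sym (ℕ.+-suc a b)))

  rowDiff-outer-pair-pos : ∀ {m} t → 3 ≤ m → 2 ℕ.+ 2 ℕ.* t ≤ m → 0ℤ ℤ.< rowDiff m t + rowDiff 0 t
  rowDiff-outer-pair-pos {m} zero 3≤m _ = subst (λ c → 0ℤ ℤ.< + c - 1ℤ + ℤ.-1ℤ) (sym (nC1≡n m)) (0<m-2 3≤m)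
    where
    0<m-2 : ∀ {m} → 3 ≤ m → 0ℤ ℤ.< + m - 1ℤ + ℤ.-1ℤ
    0<m-2 (s≤s (s≤s (s≤s z≤n))) = ℤ.+<+ (s≤s z≤n)
  rowDiff-outer-pair-pos {m} (suc t) _ 4+2t≤m =
    subst (0ℤ ℤ.<_) (sym (ℤ.+-identityʳ (rowDiff m (suc t)))) (rowDiff-pos {t = suc t} 4+2t≤m)

module HVectors where

  open FiniteSums
  open BinomialTheorem using (binomial-theorem-upTo)
  open PolynomialIdentity using (coefficients-unique)
  open RowDifferences using (rowDiff)
  open import Data.Integer using (_+_; _*_; _-_; _^_)
  open import Algebra.Properties.Ring ℤ.+-*-ring using (x[y-z]≈xy-xz)
  open import Data.Bool using (Bool; true; false; _∧_)
  open import Data.Bool.Properties using (_≟_; ∧-zeroʳ)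
  open import Data.Fin.Subset using (Subset; ∣_∣; inside; outside; ⊥)
  open import Data.List using ([]; _∷_; map; filter; length; _++_)
  open import Data.List.Properties using (filter-++; length-++; filter-none)
  open import Data.List.Relation.Unary.All using (universal)
  open import Data.Vec using (_∷_)
  open import Relation.Nullary using (does)
  open import Relation.Unary using (Pred; Decidable)

  sumTo-reflect-powers : ∀ d (f : ℕ → ℤ) x → sumTo d (λ i → f i * x ^ (d ∸ i)) ≡ sumTo d (λ k → f (d ∸ k) * x ^ k)
  sumTo-reflect-powers d f x =
    trans (sumTo-reverse d _) (sumTo-cong d (λ k k≤d → cong (λ j → f (d ∸ k) * x ^ j) (ℕ.m∸[m∸n]≡n k≤d)))

  sumTo-expand-shifted-powers : ∀ d (h : ℕ → ℤ) x →
    sumTo d (λ i → h i * (x + 1ℤ) ^ (d ∸ i)) ≡ sumTo d (λ k → sumTo d (λ i → h i * + ((d ∸ i) C k)) * x ^ k)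
  sumTo-expand-shifted-powers d h x = begin
    sumTo d (λ i → h i * (x + 1ℤ) ^ (d ∸ i))
      ≡⟨ sumTo-cong d (λ i _ → cong (h i *_) (binomial-theorem-upTo x (ℕ.m∸n≤m d i))) ⟩
    sumTo d (λ i → h i * sumTo d (λ k → + ((d ∸ i) C k) * x ^ k))
      ≡⟨ sumTo-cong d (λ i _ → *-distribˡ-sumTo d (h i) _) ⟩
    sumTo d (λ i → sumTo d (λ k → h i * (+ ((d ∸ i) C k) * x ^ k)))
      ≡⟨ sumTo-comm d d _ ⟩
    sumTo d (λ k → sumTo d (λ i → h i * (+ ((d ∸ i) C k) * x ^ k)))
      ≡⟨ sumTo-cong d (λ k _ → sumTo-cong d (λ i _ → sym (ℤ.*-assoc (h i) _ _))) ⟩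
    sumTo d (λ k → sumTo d (λ i → h i * + ((d ∸ i) C k) * x ^ k))
      ≡⟨ sumTo-cong d (λ k _ → *-distribʳ-sumTo d (x ^ k) _) ⟨
    sumTo d (λ k → sumTo d (λ i → h i * + ((d ∸ i) C k)) * x ^ k)
      ∎
    where open ≡-Reasoning

  length-filter-map : ∀ {a b p} {A : Set a} {B : Set b} {P : Pred B p} (P? : Decidable P) (g : A → B) xs →
                      length (filter P? (map g xs)) ≡ length (filter (P? ∘ g) xs)
  length-filter-map P? g []       = refl
  length-filter-map P? g (x ∷ xs) with does (P? (g x))
  ... | true  = cong suc (length-filter-map P? g xs)
  ... | false = length-filter-map P? g xs

  allSubsets-size-zero : ∀ n (p : Subset n → Bool) → p ⊥ ≡ true →
                     length (filter (λ σ → p σ ∧ (∣ σ ∣ ℕ.≡ᵇ 0) ≟ true) (allSubsets n)) ≡ 1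
  allSubsets-size-zero zero    p p⊥ rewrite p⊥ = refl
  allSubsets-size-zero (suc n) p p⊥ = begin
    length (filter Q? (map (inside ∷_) S ++ map (outside ∷_) S))
      ≡⟨ cong length (filter-++ Q? (map (inside ∷_) S) _) ⟩
    length (filter Q? (map (inside ∷_) S) ++ filter Q? (map (outside ∷_) S))
      ≡⟨ length-++ (filter Q? (map (inside ∷_) S)) ⟩
    length (filter Q? (map (inside ∷_) S)) ℕ.+ length (filter Q? (map (outside ∷_) S))
      ≡⟨ cong₂ ℕ._+_ (length-filter-map Q? (inside ∷_) S) (length-filter-map Q? (outside ∷_) S) ⟩
    length (filter (Q? ∘ (inside ∷_)) S) ℕ.+ length (filter (Q? ∘ (outside ∷_)) S)
      ≡⟨ cong₂ ℕ._+_ (cong length (filter-none (Q? ∘ (inside ∷_)) (universal nonempty S)))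
                     (allSubsets-size-zero n (p ∘ (outside ∷_)) p⊥) ⟩
    1 ∎
    where
    open ≡-Reasoning
    Q? = λ (σ : Subset (suc n)) → p σ ∧ (∣ σ ∣ ℕ.≡ᵇ 0) ≟ true
    S = allSubsets n
    nonempty : ∀ σ → p (inside ∷ σ) ∧ false ≢ true
    nonempty σ eq with () ← trans (sym (∧-zeroʳ (p (inside ∷ σ)))) eq

  faceCount-empty : ∀ {n} (Δ : SimplicialComplex n) → faceCount Δ 0 ≡ 1
  faceCount-empty {n} Δ = allSubsets-size-zero n (isFace Δ) (emptyFace Δ)

  module _ {n} (Δ : SimplicialComplex n) (d : ℕ) (h : ℕ → ℤ) (isH : IsHVector Δ d h) where

    hVector-coefficient : ∀ k → k ≤ d → + faceCount Δ (d ∸ k) ≡ sumTo d (λ i → h i * + ((d ∸ i) C k))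
    hVector-coefficient = coefficients-unique d _ _ λ y → begin
      sumTo d (λ k → + faceCount Δ (d ∸ k) * X y ^ k)              ≡⟨ sumTo-reflect-powers d (λ i → + faceCount Δ i) (X y) ⟨
      sumTo d (λ i → + faceCount Δ i * X y ^ (d ∸ i))              ≡⟨ isH (X y) ⟩
      sumTo d (λ i → h i * (X y + 1ℤ) ^ (d ∸ i))                   ≡⟨ sumTo-expand-shifted-powers d h (X y) ⟩
      sumTo d (λ k → sumTo d (λ i → h i * + ((d ∸ i) C k)) * X y ^ k) ∎
      where
      open ≡-Reasoning
      X : ℕ → ℤ
      X y = + suc y

    h₀≡1 : h 0 ≡ 1ℤ
    h₀≡1 = begin
      h 0                                          ≡⟨ ℤ.*-identityʳ (h 0) ⟨
      h 0 * + 1                                    ≡⟨ cong (λ c → h 0 * + c) (nCn≡1 d) ⟨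
      sumTo 0 (λ i → h i * + ((d ∸ i) C d))        ≡⟨ sumTo-truncate d z≤n vanishing ⟨
      sumTo d (λ i → h i * + ((d ∸ i) C d))        ≡⟨ hVector-coefficient d ℕ.≤-refl ⟨
      + faceCount Δ (d ∸ d)                        ≡⟨ cong (λ k → + faceCount Δ k) (ℕ.n∸n≡0 d) ⟩
      + faceCount Δ 0                              ≡⟨ cong +_ (faceCount-empty Δ) ⟩
      1ℤ                                           ∎
      where
      open ≡-Reasoning
      vanishing : ∀ i → 0 < i → i ≤ d → h i * + ((d ∸ i) C d) ≡ 0ℤ
      vanishing i 0<i i≤d rewrite k>n⇒nCk≡0 (ℕ.∸-monoʳ-< 0<i i≤d) = ℤ.*-zeroʳ (h i)

    faceCount-gap : ∀ t → suc t ≤ d →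
                    + faceCount Δ (d ∸ suc t) - + faceCount Δ (d ∸ t) ≡ sumTo d (λ i → h i * rowDiff (d ∸ i) t)
    faceCount-gap t 1+t≤d = begin
      + faceCount Δ (d ∸ suc t) - + faceCount Δ (d ∸ t)
        ≡⟨ cong₂ _-_ (hVector-coefficient (suc t) 1+t≤d) (hVector-coefficient t (ℕ.<⇒≤ 1+t≤d)) ⟩
      sumTo d (λ i → h i * + ((d ∸ i) C suc t)) - sumTo d (λ i → h i * + ((d ∸ i) C t))
        ≡⟨ sumTo-distrib-minus d _ _ ⟨
      sumTo d (λ i → h i * + ((d ∸ i) C suc t) - h i * + ((d ∸ i) C t))
        ≡⟨ sumTo-cong d (λ i _ → x[y-z]≈xy-xz (h i) _ _) ⟨
      sumTo d (λ i → h i * rowDiff (d ∸ i) t)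
        ∎
      where open ≡-Reasoning

module FaceNumbers where

  open IntegerOrder
  open FiniteSums
  open BinomialRows using (2+4t≤m+m⇒1+2t≤m)
  open RowDifferences
  open HVectors
  open import Data.Integer using (_+_; _*_; _-_)
  open import Data.Product using (_×_; proj₁; proj₂)

  module _ {n} (Δ : SimplicialComplex n) (d : ℕ) (h : ℕ → ℤ) (isH : IsHVector Δ d h) (3≤d : 3 ≤ d)
           (h-sym : ∀ i → i ℕ.+ i ≤ d → h (d ∸ i) ℤ.≤ h i × 0ℤ ℤ.≤ h (d ∸ i))
           (t : ℕ) (2+4t≤d : 2 ℕ.+ 4 ℕ.* t ≤ d) where

    gapTerm : ℕ → ℤ
    gapTerm i = h i * rowDiff (d ∸ i) t

    gapTerm-pair-nonneg : ∀ i → i ℕ.+ i ≤ d → 0ℤ ℤ.≤ gapTerm i + gapTerm (d ∸ i)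
    gapTerm-pair-nonneg i i+i≤d = subst (λ k → 0ℤ ℤ.≤ gapTerm i + h (d ∸ i) * rowDiff k t) (sym (ℕ.m∸[m∸n]≡n i≤d))
      (weighted-pair-nonneg (proj₂ (h-sym i i+i≤d)) (proj₁ (h-sym i i+i≤d))
        (rowDiff-nonneg {t = t} (2+4t≤m+m⇒1+2t≤m {t = t} 2+4t≤[d-i]+[d-i]))
        (rowDiff-pair-nonneg t i≤d-i 2+4t≤[d-i]+i))
      where
      i≤d : i ≤ d
      i≤d = ℕ.m+n≤o⇒m≤o i i+i≤d
      i≤d-i : i ≤ d ∸ i
      i≤d-i = ℕ.m+n≤o⇒m≤o∸n i i+i≤d
      2+4t≤[d-i]+i : 2 ℕ.+ 4 ℕ.* t ≤ (d ∸ i) ℕ.+ i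
      2+4t≤[d-i]+i = ℕ.≤-trans 2+4t≤d (ℕ.≤-reflexive (sym (ℕ.m∸n+n≡m i≤d)))
      2+4t≤[d-i]+[d-i] : 2 ℕ.+ 4 ℕ.* t ≤ (d ∸ i) ℕ.+ (d ∸ i)
      2+4t≤[d-i]+[d-i] = ℕ.≤-trans 2+4t≤[d-i]+i (ℕ.+-monoʳ-≤ (d ∸ i) i≤d-i)

    2+2t≤d : 2 ℕ.+ 2 ℕ.* t ≤ d
    2+2t≤d = ℕ.≤-trans (ℕ.+-monoʳ-≤ 2 (ℕ.*-monoˡ-≤ t (ℕ.m≤m+n 2 2))) 2+4t≤d

    gapTerm-outer-pair-pos : 0ℤ ℤ.< gapTerm 0 + gapTerm d
    gapTerm-outer-pair-pos rewrite ℕ.n∸n≡0 d =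
      weighted-pair-pos 0<h₀ (proj₂ (h-sym 0 z≤n)) (proj₁ (h-sym 0 z≤n))
        (rowDiff-pos {t = t} 2+2t≤d) (rowDiff-outer-pair-pos t 3≤d 2+2t≤d)
      where
      0<h₀ : 0ℤ ℤ.< h 0
      0<h₀ = subst (0ℤ ℤ.<_) (sym (h₀≡1 Δ d h isH)) (ℤ.+<+ (s≤s z≤n))

    faceCount-decreasing : faceCount Δ (d ∸ t) < faceCount Δ (d ∸ suc t)
    faceCount-decreasing = ℤ.drop‿+<+ (0<i-j⇒j<i (begin-strict
      0ℤ                                                   <⟨ 0<sumTo-by-pairing d gapTerm gapTerm-pair-nonneg gapTerm-outer-pair-pos ⟩
      sumTo d gapTerm                                      ≡⟨ faceCount-gap Δ d h isH t 1+t≤d ⟨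
      + faceCount Δ (d ∸ suc t) - + faceCount Δ (d ∸ t)    ∎))
      where
      open ℤ.≤-Reasoning
      1+t≤d : suc t ≤ d
      1+t≤d = ℕ.≤-trans (ℕ.+-monoʳ-≤ 1 (ℕ.m≤n*m t 2)) (ℕ.≤-trans (ℕ.n≤1+n _) 2+2t≤d)

open FaceNumbers using (faceCount-decreasing)
open import Data.Nat using (_+_; _*_; _/_; _%_)
open import Data.Nat.DivMod using (m≡m%n+[m/n]*n; m%n<n; m*n/n≡m; /-monoˡ-≤)
open import Data.Nat.Solver using (module +-*-Solver)
open import Data.Product using (_×_)
open +-*-Solver using (solve; _:=_; _:+_; _:*_; con)

i+i≤d⇒i≤d/2 : ∀ {i d} → i + i ≤ d → i ≤ d / 2
i+i≤d⇒i≤d/2 {i} {d} i+i≤d = begin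
  i              ≡⟨ m*n/n≡m i 2 ⟨
  i * 2 / 2      ≤⟨ /-monoˡ-≤ 2 (ℕ.≤-trans (ℕ.≤-reflexive (solve 1 (λ i → i :* con 2 := i :+ i) refl i)) i+i≤d) ⟩
  d / 2          ∎
  where open ℕ.≤-Reasoning

m∸[1+[m∸[1+n]]]≡n : ∀ {m n} → suc n ≤ m → m ∸ suc (m ∸ suc n) ≡ n
m∸[1+[m∸[1+n]]]≡n {m} {n} 1+n≤m =
  trans (sym (ℕ.pred[m∸n]≡m∸[1+n] m (m ∸ suc n))) (cong ℕ.pred (ℕ.m∸[m∸n]≡n 1+n≤m))

floor-bound : ∀ t j → 3 * (t + suc j) / 4 ≤ j → 2 + 4 * t ≤ t + (2 + j)
floor-bound t j lower = begin
  2 + 4 * t          ≡⟨ solve 1 (λ t → con 2 :+ con 4 :* t := t :+ (con 2 :+ con 3 :* t)) refl t ⟩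
  t + (2 + 3 * t)    ≤⟨ ℕ.+-monoʳ-≤ t (ℕ.+-monoʳ-≤ 2 3t≤j) ⟩
  t + (2 + j)        ∎
  where
  open ℕ.≤-Reasoning
  x = 3 * (t + suc j)
  x≤3+4j : x ≤ 3 + j * 4
  x≤3+4j = begin
    x                      ≡⟨ m≡m%n+[m/n]*n x 4 ⟩
    x % 4 + x / 4 * 4      ≤⟨ ℕ.+-mono-≤ (ℕ.≤-pred (m%n<n x 4)) (ℕ.*-monoˡ-≤ 4 lower) ⟩
    3 + j * 4              ∎
  3t≤j : 3 * t ≤ j
  3t≤j = ℕ.+-cancelˡ-≤ (3 + 3 * j) _ _ (begin
    3 + 3 * j + 3 * t      ≡⟨ solve 2 (λ t j → con 3 :+ con 3 :* j :+ con 3 :* t := con 3 :* (t :+ (con 1 :+ j))) refl t j ⟩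
    x                      ≤⟨ x≤3+4j ⟩
    3 + j * 4              ≡⟨ solve 1 (λ j → con 3 :+ j :* con 4 := con 3 :+ con 3 :* j :+ j) refl j ⟩
    3 + 3 * j + j          ∎)

codimension-bound : ∀ {d j} → 2 + j ≤ d → 3 * (d ∸ 1) / 4 ≤ j → 2 + 4 * (d ∸ (2 + j)) ≤ d
codimension-bound {d} {j} 2+j≤d lower =
  subst (2 + 4 * t ≤_) t+[2+j]≡d (floor-bound t j (subst (λ m → 3 * m / 4 ≤ j) d∸1≡t+[1+j] lower))
  where
  t = d ∸ (2 + j)
  t+[2+j]≡d : t + (2 + j) ≡ d
  t+[2+j]≡d = ℕ.m∸n+n≡m 2+j≤d
  d∸1≡t+[1+j] : d ∸ 1 ≡ t + suc j
  d∸1≡t+[1+j] = trans (cong (_∸ 1) (sym t+[2+j]≡d)) (cong (_∸ 1) (ℕ.+-suc t (suc j)))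

proposition3 : (d n : ℕ) → 3 ≤ d → (Δ : SimplicialComplex n) → HasDim-1 Δ d →
    d < fv Δ 0 → (h : ℕ → ℤ) → IsHVector Δ d h →
    (∀ i → i ≤ d / 2 → (h (d ∸ i) ℤ.≤ h i) × (ℤ.0ℤ ℤ.≤ h (d ∸ i))) →
    ∀ j → (3 * (d ∸ 1)) / 4 ≤ j → j < d ∸ 1 → fv Δ (suc j) < fv Δ j
proposition3 d n 3≤d Δ _ _ h isH h-sym j lower upper =
  subst₂ _<_ (cong (faceCount Δ) (ℕ.m∸[m∸n]≡n 2+j≤d)) (cong (faceCount Δ) (m∸[1+[m∸[1+n]]]≡n 2+j≤d))
    (faceCount-decreasing Δ d h isH 3≤d (λ i i+i≤d → h-sym i (i+i≤d⇒i≤d/2 i+i≤d))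
      (d ∸ (2 + j)) (codimension-bound 2+j≤d lower))
  where
  2+j≤d : 2 + j ≤ d
  2+j≤d = subst (_≤ d) (ℕ.+-comm (suc j) 1) (ℕ.m≤o∸n⇒m+n≤o (suc j) (ℕ.≤-trans (s≤s z≤n) 3≤d) upper)
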